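{- Run the colouring procedure (described in the context) on an Eulerian directed multigraph $G$. Upon termination, all edges of $G$ are \textsc{Dashed}.
   Context: $G=(V,E)$ is a finite directed multigraph (loops and parallel edges allowed), Eulerian: strongly connected and every vertex has in-degree equal to out-degree. Colouring procedure: each edge has a colour in $\{\textsc{Black},\textsc{Red},\textsc{Green},\textsc{Dashed}\}$, initially all \textsc{Black}. Choose a start vertex $v_0$; the current vertex is $u=v_0$, and $v_0$ is marked reached. Repeat: if some \textsc{Black} edge $wu$ enters the current vertex $u$, pick one, colour it \textsc{Red} if $w$ was not yet reached (and mark $w$ reached), otherwise \textsc{Green}, and make $w$ current. Otherwise: if some \textsc{Green} edge $uw$ leaves $u$, colour it \textsc{Dashed}, output it, make $w$ current; else if $u\ne v_0$, colour the unique \textsc{Red} edge $uw$ leaving $u$ \textsc{Dashed}, output it, make $w$ current; else ($u=v_0$) terminate. -}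

module Defs where

open import Data.Nat using (ℕ)
open import Data.Fin using (Fin; _≟_)
open import Data.Bool using (Bool; true; false; if_then_else_)
open import Data.List using (length; filter)
open import Data.List.Base using (List)
open import Data.Fin.Base using ()
open import Data.List using () renaming (List to L)
open import Data.Vec.Functional using ()
open import Data.Product using (_×_)
open import Relation.Nullary using (¬_; Dec; yes; no)
open import Relation.Nullary.Decidable using (does)
open import Relation.Binary.PropositionalEquality using (_≡_; _≢_)
open import Data.List using (allFin)

record Multigraph : Set where
  field
    n   : ℕ
    m   : ℕ
    src : Fin m → Fin n
    tgt : Fin m → Fin n

module _ (G : Multigraph) where
  open Multigraph G

  indeg : Fin n → ℕ
  indeg v = length (filter (λ e → tgt e ≟ v) (allFin m))

  outdeg : Fin n → ℕ
  outdeg v = length (filter (λ e → src e ≟ v) (allFin m))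

  data Reach : Fin n → Fin n → Set where
    here : ∀ {u} → Reach u u
    step : ∀ {v} (e : Fin m) → Reach (tgt e) v → Reach (src e) v

  StronglyConnected : Set
  StronglyConnected = ∀ u v → Reach u v

  Eulerian : Set
  Eulerian = StronglyConnected × (∀ v → indeg v ≡ outdeg v)

data Colour : Set where
  Black Red Green Dashed : Colour

module Procedure (G : Multigraph) (v₀ : Fin (Multigraph.n G)) where
  open Multigraph G

  record State : Set where
    constructor ⟨_,_,_⟩
    field
      colour  : Fin m → Colour
      reached : Fin n → Bool
      current : Fin n
  open State public

  recolour : (Fin m → Colour) → Fin m → Colour → Fin m → Colour
  recolour c e k e' = if does (e' ≟ e) then k else c e'

  mark : (Fin n → Bool) → Fin n → Fin n → Bool
  mark r w w' = if does (w' ≟ w) then true else r w'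

  initial : State
  initial = ⟨ (λ _ → Black) , mark (λ _ → false) v₀ , v₀ ⟩

  NoBlackIn : State → Set
  NoBlackIn s = ∀ e → tgt e ≡ current s → colour s e ≢ Black

  NoGreenOut : State → Set
  NoGreenOut s = ∀ e → src e ≡ current s → colour s e ≢ Green

  data Step : State → State → Set where
    black-new : ∀ {c r u} (e : Fin m) → tgt e ≡ u → c e ≡ Black → r (src e) ≡ false →
      Step ⟨ c , r , u ⟩ ⟨ recolour c e Red , mark r (src e) , src e ⟩
    black-old : ∀ {c r u} (e : Fin m) → tgt e ≡ u → c e ≡ Black → r (src e) ≡ true →
      Step ⟨ c , r , u ⟩ ⟨ recolour c e Green , r , src e ⟩
    green-out : ∀ {s} (e : Fin m) → NoBlackIn s → src e ≡ current s → colour s e ≡ Green →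
      Step s ⟨ recolour (colour s) e Dashed , reached s , tgt e ⟩
    red-out : ∀ {s} (e : Fin m) → NoBlackIn s → NoGreenOut s → current s ≢ v₀ →
      src e ≡ current s → colour s e ≡ Red →
      Step s ⟨ recolour (colour s) e Dashed , reached s , tgt e ⟩

  Terminated : State → Set
  Terminated s = current s ≡ v₀ × NoBlackIn s × NoGreenOut s

{-# OPTIONS --safe #-}
module Submission where

-- Call Red and Green edges pending: they have been traversed backwards but not yet
-- forwards, so they form a unit flow from the current vertex to v₀.  The Red edges form
-- a tree towards v₀ (each has a Red walk to v₀ and none leaves v₀), and a reached vertex
-- other than v₀ keeps a Red out-edge until all its in-edges are Dashed: when that edge is
-- followed it is the only pending edge leaving the vertex, so by conservation no pending
-- edge enters it.  At termination the walk is back at v₀ with nothing pending leaving it,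
-- hence nothing pending enters it.  So no Red edge survives, every reached vertex has only
-- Dashed in-edges, the reached set is closed under predecessors, and strong connectivity
-- makes every vertex reached and every edge Dashed.

open import Defs
open import Algebra.Properties.CommutativeMonoid.Sum as Sum using ()
open import Data.Bool using (Bool; true; false; if_then_else_)
open import Data.Fin using (Fin; _≟_)
open import Data.Fin.Properties using (punchInᵢ≢i)
open import Data.Nat using (ℕ; suc; _+_; _*_)
open import Data.Nat.Properties
  using (+-0-commutativeMonoid; +-assoc; +-comm; +-identityʳ; +-cancelʳ-≡; +-cancelˡ-≡; *-suc; m+n≡0⇒m≡0)
open import Data.Product using (∃-syntax; _×_; _,_; proj₁; proj₂)
open import Data.Sum using (_⊎_; inj₁; inj₂; [_,_]; map)
open import Data.Vec.Functional using (Vector; removeAt)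
open import Function using (_∘_; id)
open import Relation.Binary.Construct.Closure.ReflexiveTransitive using (Star; ε; _◅_)
open import Relation.Binary.PropositionalEquality
  using (_≡_; _≢_; refl; sym; trans; cong; cong₂; subst; module ≡-Reasoning)
open import Relation.Nullary using (¬_; yes; no; contradiction)
open import Relation.Nullary.Decidable using (does)

open Sum +-0-commutativeMonoid using (sum; sum-remove; sum-cong-≗; sum-replicate-zero)

sum-≡0⁺ : ∀ {k} (t : Vector ℕ k) → (∀ i → t i ≡ 0) → sum t ≡ 0
sum-≡0⁺ {k} t t≡0 = trans (sum-cong-≗ t≡0) (sum-replicate-zero k)

sum-≡0⁻ : ∀ {k} (t : Vector ℕ k) → sum t ≡ 0 → ∀ i → t i ≡ 0
sum-≡0⁻ {suc k} t Σt≡0 i = m+n≡0⇒m≡0 (t i) (trans (sym (sum-remove {i = i} t)) Σt≡0)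

sum-single : ∀ {k} (t : Vector ℕ k) i → (∀ j → j ≢ i → t j ≡ 0) → sum t ≡ t i
sum-single {suc k} t i rest≡0 = begin
  sum t                      ≡⟨ sum-remove {i = i} t ⟩
  t i + sum (removeAt t i)   ≡⟨ cong (t i +_) (sum-≡0⁺ _ (λ j → rest≡0 _ (punchInᵢ≢i i j))) ⟩
  t i + 0                    ≡⟨ +-identityʳ (t i) ⟩
  t i                        ∎
  where open ≡-Reasoning

sum-bump : ∀ {k} (t t′ : Vector ℕ k) i d → (∀ j → j ≢ i → t′ j ≡ t j) → t′ i ≡ d + t i →
           sum t′ ≡ d + sum t
sum-bump {suc k} t t′ i d off at = begin
  sum t′                            ≡⟨ sum-remove {i = i} t′ ⟩
  t′ i + sum (removeAt t′ i)        ≡⟨ cong₂ _+_ at (sum-cong-≗ (λ j → off _ (punchInᵢ≢i i j))) ⟩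
  d + t i + sum (removeAt t i)      ≡⟨ +-assoc d (t i) _ ⟩
  d + (t i + sum (removeAt t i))    ≡⟨ cong (d +_) (sym (sum-remove {i = i} t)) ⟩
  d + sum t                         ∎
  where open ≡-Reasoning

≡-≢-trans : ∀ {A : Set} {x y z : A} → x ≡ y → y ≢ z → x ≢ z
≡-≢-trans refl y≢z = y≢z

pending : Colour → ℕ
pending Red    = 1
pending Green  = 1
pending Black  = 0
pending Dashed = 0

pending-≡0 : ∀ {k} → k ≢ Red → k ≢ Green → pending k ≡ 0
pending-≡0 {Red}    k≢R _   = contradiction refl k≢R
pending-≡0 {Green}  _   k≢G = contradiction refl k≢G
pending-≡0 {Black}  _   _   = refl
pending-≡0 {Dashed} _   _   = refl

idle⇒Dashed : ∀ {k} → pending k ≡ 0 → k ≢ Black → k ≡ Dashed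
idle⇒Dashed {Black}  _  k≢B = contradiction refl k≢B
idle⇒Dashed {Dashed} _  _   = refl

module Flow (G : Multigraph) where
  open Multigraph G

  δ : Fin n → Fin n → ℕ
  δ a b = if does (a ≟ b) then 1 else 0

  δ-refl : ∀ a → δ a a ≡ 1
  δ-refl a with a ≟ a
  ... | yes _   = refl
  ... | no a≢a = contradiction refl a≢a

  δ-≢ : ∀ {a b} → a ≢ b → δ a b ≡ 0
  δ-≢ {a} {b} a≢b with a ≟ b
  ... | yes a≡b = contradiction a≡b a≢b
  ... | no _    = refl

  δ-*-≡0 : ∀ {a b} k → (a ≡ b → k ≡ 0) → δ a b * k ≡ 0
  δ-*-≡0 {a} {b} k a≡b⇒k≡0 with a ≟ b
  ... | yes a≡b = trans (+-identityʳ k) (a≡b⇒k≡0 a≡b)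
  ... | no _    = refl

  flow : (Fin m → Fin n) → (Fin m → ℕ) → Fin n → ℕ
  flow end w x = sum (λ i → δ (end i) x * w i)

  flow-≡0⁺ : ∀ end {w x} → (∀ i → end i ≡ x → w i ≡ 0) → flow end w x ≡ 0
  flow-≡0⁺ end {w} idle = sum-≡0⁺ _ (λ i → δ-*-≡0 (w i) (idle i))

  flow-≡0⁻ : ∀ end {w x} → flow end w x ≡ 0 → ∀ i → end i ≡ x → w i ≡ 0
  flow-≡0⁻ end {w} {x} Σ≡0 i refl =
    trans (sym (+-identityʳ (w i))) (subst (λ d → d * w i ≡ 0) (δ-refl x) (sum-≡0⁻ _ Σ≡0 i))

  flow-single : ∀ end {w x} e → end e ≡ x → (∀ i → end i ≡ x → i ≢ e → w i ≡ 0) → flow end w x ≡ w e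
  flow-single end {w} {x} e refl idle =
    trans (sum-single _ e (λ i i≢e → δ-*-≡0 (w i) (λ endᵢ≡x → idle i endᵢ≡x i≢e)))
          (trans (cong (_* w e) (δ-refl x)) (+-identityʳ (w e)))

  flow-bump : ∀ end {w w′ x} e → (∀ i → i ≢ e → w′ i ≡ w i) → w′ e ≡ suc (w e) →
              flow end w′ x ≡ δ (end e) x + flow end w x
  flow-bump end {w} {w′} {x} e off at =
    sum-bump _ _ e (δ (end e) x) (λ i i≢e → cong (δ (end i) x *_) (off i i≢e))
             (trans (cong (δ (end e) x *_) at) (*-suc (δ (end e) x) (w e)))

  -- Net out-flow at x is δ s x − δ t x: one unit travels from s to t (none when s ≡ t).
  record UnitFlow (w : Fin m → ℕ) (s t : Fin n) : Set where
    constructor unitFlow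
    field conserved : ∀ x → flow src w x + δ t x ≡ flow tgt w x + δ s x

  unitFlow-extend : ∀ {w w′ s t} e → (∀ i → i ≢ e → w′ i ≡ w i) → w′ e ≡ suc (w e) → tgt e ≡ s →
                    UnitFlow w s t → UnitFlow w′ (src e) t
  unitFlow-extend {w} {w′} {s} {t} e off at refl (unitFlow balanced) = unitFlow λ x → begin
    flow src w′ x + δ t x               ≡⟨ cong (_+ δ t x) (flow-bump src e off at) ⟩
    δ (src e) x + flow src w x + δ t x  ≡⟨ +-assoc (δ (src e) x) _ _ ⟩
    δ (src e) x + (flow src w x + δ t x) ≡⟨ cong (δ (src e) x +_) (balanced x) ⟩
    δ (src e) x + (flow tgt w x + δ s x) ≡⟨ +-comm (δ (src e) x) _ ⟩
    flow tgt w x + δ s x + δ (src e) x  ≡⟨ cong (_+ δ (src e) x) (+-comm (flow tgt w x) (δ s x)) ⟩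
    δ s x + flow tgt w x + δ (src e) x  ≡⟨ cong (_+ δ (src e) x) (flow-bump tgt e off at) ⟨
    flow tgt w′ x + δ (src e) x         ∎
    where open ≡-Reasoning

  unitFlow-retract : ∀ {w w′ s t} e → (∀ i → i ≢ e → w i ≡ w′ i) → w e ≡ suc (w′ e) → src e ≡ s →
                     UnitFlow w s t → UnitFlow w′ (tgt e) t
  unitFlow-retract {w} {w′} {s} {t} e off at refl (unitFlow balanced) =
    unitFlow λ x → +-cancelˡ-≡ (δ s x) _ _ (begin
    δ s x + (flow src w′ x + δ t x)     ≡⟨ +-assoc (δ s x) _ _ ⟨
    δ s x + flow src w′ x + δ t x       ≡⟨ cong (_+ δ t x) (flow-bump src e off at) ⟨
    flow src w x + δ t x                ≡⟨ balanced x ⟩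
    flow tgt w x + δ s x                ≡⟨ cong (_+ δ s x) (flow-bump tgt e off at) ⟩
    δ (tgt e) x + flow tgt w′ x + δ s x ≡⟨ +-comm _ (δ s x) ⟩
    δ s x + (δ (tgt e) x + flow tgt w′ x) ≡⟨ cong (δ s x +_) (+-comm (δ (tgt e) x) _) ⟩
    δ s x + (flow tgt w′ x + δ (tgt e) x) ∎)
    where open ≡-Reasoning

  unitFlow-no-inflow : ∀ {w s t x} → UnitFlow w s t → flow src w x + δ t x ≡ δ s x → flow tgt w x ≡ 0
  unitFlow-no-inflow {w} {s} {t} {x} (unitFlow balanced) out≡ =
    +-cancelʳ-≡ (δ s x) _ 0 (trans (sym (balanced x)) out≡)

module Walks (G : Multigraph) where
  open Multigraph G

  data Walk (P : Fin m → Set) (t : Fin n) : Fin n → Set where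
    here : Walk P t t
    step : ∀ e → P e → Walk P t (tgt e) → Walk P t (src e)

  walk-mono : ∀ {P Q : Fin m → Set} {t x} → (∀ {e} → P e → Q e) → Walk P t x → Walk Q t x
  walk-mono P⇒Q here            = here
  walk-mono P⇒Q (step e p walk) = step e (P⇒Q p) (walk-mono P⇒Q walk)

  walk-last-edge : ∀ {P t x} → Walk P t x → x ≢ t → ∃[ e ] tgt e ≡ t × P e
  walk-last-edge here             x≢t = contradiction refl x≢t
  walk-last-edge {t = t} (step e p walk) _ with tgt e ≟ t
  ... | yes tgtₑ≡t = e , tgtₑ≡t , p
  ... | no tgtₑ≢t  = walk-last-edge walk tgtₑ≢t

  walk-avoids : ∀ {P t x u} → Walk P t x → x ≢ u → (∀ e → P e → tgt e ≢ u) →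
                Walk (λ e → P e × src e ≢ u) t x
  walk-avoids here            _   _        = here
  walk-avoids (step e p walk) x≢u never-in =
    step e (p , x≢u) (walk-avoids walk (never-in e p) never-in)

  reach-backwards : ∀ {Q : Fin n → Set} {x y} → (∀ e → Q (tgt e) → Q (src e)) → Reach G x y → Q y → Q x
  reach-backwards closed here          q = q
  reach-backwards closed (step e walk) q = closed e (reach-backwards closed walk q)

module Correctness (G : Multigraph) (v₀ : Fin (Multigraph.n G)) where
  open Multigraph G
  open Procedure G v₀
  open Flow G
  open Walks G

  Colouring : Set
  Colouring = Fin m → Colour

  recolour-at : ∀ (c : Colouring) e k → recolour c e k e ≡ k
  recolour-at c e k with e ≟ e
  ... | yes _   = refl
  ... | no e≢e = contradiction refl e≢e

  recolour-off : ∀ (c : Colouring) {e k i} → i ≢ e → recolour c e k i ≡ c i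
  recolour-off c {e} {i = i} i≢e with i ≟ e
  ... | yes i≡e = contradiction i≡e i≢e
  ... | no _    = refl

  recolour-keeps : ∀ (c : Colouring) e {k} i {col} → (i ≡ e → k ≡ col) → c i ≡ col → recolour c e k i ≡ col
  recolour-keeps c e i at-e cᵢ≡col with i ≟ e
  ... | yes i≡e = at-e i≡e
  ... | no _    = cᵢ≡col

  recolour-red : ∀ (c : Colouring) e {k} i → recolour c e k i ≡ Red → (i ≡ e × k ≡ Red) ⊎ c i ≡ Red
  recolour-red c e i red with i ≟ e
  ... | yes i≡e = inj₁ (i≡e , red)
  ... | no _    = inj₂ red

  red-before : ∀ (c : Colouring) e {k} i → recolour c e k i ≡ Red → k ≢ Red → c i ≡ Red
  red-before c e i red k≢Red = [ (λ (_ , k≡Red) → contradiction k≡Red k≢Red) , id ] (recolour-red c e i red)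

  pending-off : ∀ (c : Colouring) {e k} i → i ≢ e → pending (recolour c e k i) ≡ pending (c i)
  pending-off c i i≢e = cong pending (recolour-off c i≢e)

  mark-here : ∀ r w → mark r w w ≡ true
  mark-here r w with w ≟ w
  ... | yes _   = refl
  ... | no w≢w = contradiction refl w≢w

  mark-⊇ : ∀ r w {x} → r x ≡ true → mark r w x ≡ true
  mark-⊇ r w {x} rx with x ≟ w
  ... | yes _ = refl
  ... | no _  = rx

  mark-cases : ∀ r w {x} → mark r w x ≡ true → x ≡ w ⊎ r x ≡ true
  mark-cases r w {x} rx with x ≟ w
  ... | yes x≡w = inj₁ x≡w
  ... | no _    = inj₂ rx

  HasRedOut : Colouring → Fin n → Set
  HasRedOut c x = ∃[ e ] src e ≡ x × c e ≡ Red

  Finished : Colouring → Fin n → Set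
  Finished c x = ∀ e → tgt e ≡ x → c e ≡ Dashed

  RedWalk : Colouring → Fin n → Set
  RedWalk c = Walk (λ e → c e ≡ Red) v₀

  HasRedOut-recolour : ∀ {c e k x} → (src e ≡ x → c e ≢ Red) →
                       HasRedOut c x → HasRedOut (recolour c e k) x
  HasRedOut-recolour {c} {e} e-not-red (i , refl , cᵢ≡Red) =
    i , refl , recolour-keeps c e i (λ { refl → contradiction cᵢ≡Red (e-not-red refl) }) cᵢ≡Red

  Finished-recolour : ∀ {c e k x} → (tgt e ≡ x → k ≡ Dashed) → Finished c x → Finished (recolour c e k) x
  Finished-recolour {c} {e} e-dashed finished i refl =
    recolour-keeps c e i (λ { refl → e-dashed refl }) (finished i refl)

  idle-in⇒Finished : ∀ {c x} → (∀ e → tgt e ≡ x → c e ≢ Black) → flow tgt (pending ∘ c) x ≡ 0 → Finished c x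
  idle-in⇒Finished no-black idle e tgtₑ≡x = idle⇒Dashed (flow-≡0⁻ tgt idle e tgtₑ≡x) (no-black e tgtₑ≡x)

  Reached : State → Fin n → Set
  Reached s x = reached s x ≡ true

  record Invariant (s : State) : Set where
    field
      v₀-reached      : Reached s v₀
      current-reached : Reached s (current s)
      touched-reached : ∀ e → colour s e ≢ Black → Reached s (src e) × Reached s (tgt e)
      red-unique      : ∀ e e′ → colour s e ≡ Red → colour s e′ ≡ Red → src e ≡ src e′ → e ≡ e′
      red-off-v₀      : ∀ e → colour s e ≡ Red → src e ≢ v₀
      red-walk        : ∀ e → colour s e ≡ Red → RedWalk (colour s) (src e)
      unit-flow       : UnitFlow (pending ∘ colour s) (current s) v₀
      red-or-finished : ∀ x → Reached s x → x ≢ v₀ → HasRedOut (colour s) x ⊎ Finished (colour s) x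

  initial-invariant : Invariant initial
  initial-invariant = record
    { v₀-reached      = mark-here _ v₀
    ; current-reached = mark-here _ v₀
    ; touched-reached = λ e B≢B → contradiction refl B≢B
    ; red-unique      = λ _ _ ()
    ; red-off-v₀      = λ _ ()
    ; red-walk        = λ _ ()
    ; unit-flow       = unitFlow λ x → cong (_+ δ v₀ x) (trans (flow-≡0⁺ src λ _ _ → refl)
                                                             (sym (flow-≡0⁺ tgt λ _ _ → refl)))
    ; red-or-finished = λ x reached x≢v₀ →
        [ (λ x≡v₀ → contradiction x≡v₀ x≢v₀) , (λ ()) ] (mark-cases _ v₀ reached)
    }

  touched-recolour : ∀ {c : Colouring} {r r′ : Fin n → Bool} {e k} → (∀ {x} → r x ≡ true → r′ x ≡ true) →
    r′ (src e) ≡ true → r′ (tgt e) ≡ true →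
    (∀ i → c i ≢ Black → r (src i) ≡ true × r (tgt i) ≡ true) →
    ∀ i → recolour c e k i ≢ Black → r′ (src i) ≡ true × r′ (tgt i) ≡ true
  touched-recolour {c} {e = e} r⊆r′ src-reached tgt-reached touched i not-black with i ≟ e
  ... | yes refl = src-reached , tgt-reached
  ... | no _     = let (src-r , tgt-r) = touched i not-black in r⊆r′ src-r , r⊆r′ tgt-r

  unfinished-red-walk : ∀ {s x} → Invariant s → Reached s x → ¬ Finished (colour s) x → RedWalk (colour s) x
  unfinished-red-walk {x = x} I reached unfinished with x ≟ v₀
  ... | yes refl   = here
  ... | no x≢v₀ with Invariant.red-or-finished I x reached x≢v₀
  ...   | inj₁ (e , refl , red) = Invariant.red-walk I e red
  ...   | inj₂ finished         = contradiction finished unfinished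

  recolour-keeps-red : ∀ (c : Colouring) e {k} → c e ≢ Red → ∀ {i} → c i ≡ Red → recolour c e k i ≡ Red
  recolour-keeps-red c e e-not-red {i} red =
    recolour-keeps c e i (λ { refl → contradiction red e-not-red }) red

  black-in⇒unfinished : ∀ {c : Colouring} {e} → c e ≡ Black → ¬ Finished c (tgt e)
  black-in⇒unfinished {e = e} black finished = contradiction (trans (sym black) (finished e refl)) λ ()

  red-or-finished-recolour-black : ∀ {c e k x} → c e ≡ Black →
    HasRedOut c x ⊎ Finished c x → HasRedOut (recolour c e k) x ⊎ Finished (recolour c e k) x
  red-or-finished-recolour-black {c} {e} black (inj₁ has-red) =
    inj₁ (HasRedOut-recolour {e = e} (λ _ → ≡-≢-trans black λ ()) has-red)
  red-or-finished-recolour-black {c} {e} black (inj₂ finished) =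
    inj₂ (Finished-recolour {e = e} (λ { refl → contradiction finished (black-in⇒unfinished black) })
                                     finished)

  unitFlow-backward : ∀ {c u e k} → tgt e ≡ u → c e ≡ Black → pending k ≡ 1 →
    UnitFlow (pending ∘ c) u v₀ → UnitFlow (pending ∘ recolour c e k) (src e) v₀
  unitFlow-backward {c} {e = e} {k} tgtₑ≡u black pending-k =
    unitFlow-extend e (pending-off c) (trans (cong pending (recolour-at c e k))
                                             (trans pending-k (cong (suc ∘ pending) (sym black))))
                    tgtₑ≡u

  unitFlow-forward : ∀ {c u e} → src e ≡ u → pending (c e) ≡ 1 →
    UnitFlow (pending ∘ c) u v₀ → UnitFlow (pending ∘ recolour c e Dashed) (tgt e) v₀
  unitFlow-forward {c} {e = e} srcₑ≡u pending-e =
    unitFlow-retract e (λ i i≢e → sym (pending-off c i i≢e))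
                     (trans pending-e (cong (suc ∘ pending) (sym (recolour-at c e Dashed))))
                     srcₑ≡u

  invariant-black-new : ∀ {c r u} e → tgt e ≡ u → c e ≡ Black → r (src e) ≡ false →
    Invariant ⟨ c , r , u ⟩ → Invariant ⟨ recolour c e Red , mark r (src e) , src e ⟩
  invariant-black-new {c} {r} e refl black unreached I = record
    { v₀-reached      = mark-⊇ r (src e) v₀-reached
    ; current-reached = mark-here r (src e)
    ; touched-reached = touched-recolour {r′ = mark r (src e)} (mark-⊇ r (src e)) (mark-here r (src e))
                                         (mark-⊇ r (src e) current-reached) touched-reached
    ; red-unique      = unique
    ; red-off-v₀      = λ i red → [ (λ { (refl , _) → fresh v₀-reached ∘ sym }) , red-off-v₀ i ]
                                    (recolour-red c e i red)
    ; red-walk        = walk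
    ; unit-flow       = unitFlow-backward refl black refl unit-flow
    ; red-or-finished = λ x reachedₓ x≢v₀ →
        [ (λ { refl → inj₁ (e , refl , recolour-at c e Red) })
        , (λ old → red-or-finished-recolour-black black (red-or-finished x old x≢v₀)) ]
        (mark-cases r (src e) reachedₓ)
    }
    where
    open Invariant I
    fresh : ∀ {x} → r x ≡ true → x ≢ src e
    fresh rx refl = contradiction (trans (sym rx) unreached) λ ()
    old-red-elsewhere : ∀ i → c i ≡ Red → src i ≢ src e
    old-red-elsewhere i red = fresh (proj₁ (touched-reached i (≡-≢-trans red λ ())))
    unique : ∀ i j → recolour c e Red i ≡ Red → recolour c e Red j ≡ Red → src i ≡ src j → i ≡ j
    unique i j redᵢ redⱼ srcᵢ≡srcⱼ with recolour-red c e i redᵢ | recolour-red c e j redⱼ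
    ... | inj₁ (refl , _) | inj₁ (refl , _) = refl
    ... | inj₁ (refl , _) | inj₂ oldⱼ       = contradiction (sym srcᵢ≡srcⱼ) (old-red-elsewhere j oldⱼ)
    ... | inj₂ oldᵢ       | inj₁ (refl , _) = contradiction srcᵢ≡srcⱼ (old-red-elsewhere i oldᵢ)
    ... | inj₂ oldᵢ       | inj₂ oldⱼ       = red-unique i j oldᵢ oldⱼ srcᵢ≡srcⱼ
    walk : ∀ i → recolour c e Red i ≡ Red → RedWalk (recolour c e Red) (src i)
    walk i red with recolour-red c e i red
    ... | inj₁ (refl , _) = step e (recolour-at c e Red)
          (walk-mono (recolour-keeps-red c e (≡-≢-trans black λ ()))
                     (unfinished-red-walk I current-reached (black-in⇒unfinished black)))
    ... | inj₂ old = walk-mono (recolour-keeps-red c e (≡-≢-trans black λ ())) (red-walk i old)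

  invariant-black-old : ∀ {c r u} e → tgt e ≡ u → c e ≡ Black → r (src e) ≡ true →
    Invariant ⟨ c , r , u ⟩ → Invariant ⟨ recolour c e Green , r , src e ⟩
  invariant-black-old {c} {r} e refl black reachedₑ I = record
    { v₀-reached      = v₀-reached
    ; current-reached = reachedₑ
    ; touched-reached = touched-recolour {r = r} id reachedₑ current-reached touched-reached
    ; red-unique      = λ i j redᵢ redⱼ →
        red-unique i j (red-before c e i redᵢ λ ()) (red-before c e j redⱼ λ ())
    ; red-off-v₀      = λ i red → red-off-v₀ i (red-before c e i red λ ())
    ; red-walk        = λ i red → walk-mono (recolour-keeps-red c e (≡-≢-trans black λ ()))
                                            (red-walk i (red-before c e i red λ ()))
    ; unit-flow       = unitFlow-backward refl black refl unit-flow
    ; red-or-finished = λ x reachedₓ x≢v₀ →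
        red-or-finished-recolour-black black (red-or-finished x reachedₓ x≢v₀)
    }
    where open Invariant I

  invariant-green-out : ∀ {s} e → src e ≡ current s → colour s e ≡ Green →
    Invariant s → Invariant ⟨ recolour (colour s) e Dashed , reached s , tgt e ⟩
  invariant-green-out {⟨ c , r , u ⟩} e refl green I = record
    { v₀-reached      = v₀-reached
    ; current-reached = proj₂ ends
    ; touched-reached = touched-recolour {r = r} id (proj₁ ends) (proj₂ ends) touched-reached
    ; red-unique      = λ i j redᵢ redⱼ →
        red-unique i j (red-before c e i redᵢ λ ()) (red-before c e j redⱼ λ ())
    ; red-off-v₀      = λ i red → red-off-v₀ i (red-before c e i red λ ())
    ; red-walk        = λ i red → walk-mono (recolour-keeps-red c e not-red)
                                            (red-walk i (red-before c e i red λ ()))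
    ; unit-flow       = unitFlow-forward refl (cong pending green) unit-flow
    ; red-or-finished = λ x reachedₓ x≢v₀ →
        map (HasRedOut-recolour (λ _ → not-red)) (Finished-recolour (λ _ → refl))
            (red-or-finished x reachedₓ x≢v₀)
    }
    where
    open Invariant I
    not-red : c e ≢ Red
    not-red = ≡-≢-trans green λ ()
    ends = touched-reached e (≡-≢-trans green λ ())

  red-exit⇒Finished : ∀ {c r} e → NoBlackIn ⟨ c , r , src e ⟩ → NoGreenOut ⟨ c , r , src e ⟩ →
    src e ≢ v₀ → c e ≡ Red → Invariant ⟨ c , r , src e ⟩ → Finished c (src e)
  red-exit⇒Finished {c} e no-black no-green u≢v₀ red I =
    idle-in⇒Finished no-black (unitFlow-no-inflow unit-flow (begin
      flow src (pending ∘ c) (src e) + δ v₀ (src e) ≡⟨ cong₂ _+_ (flow-single src e refl other-out-idle)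
                                                                 (δ-≢ (u≢v₀ ∘ sym)) ⟩
      pending (c e) + 0                              ≡⟨ cong (λ k → pending k + 0) red ⟩
      1 + 0                                          ≡⟨ δ-refl (src e) ⟨
      δ (src e) (src e)                              ∎))
    where
    open Invariant I
    open ≡-Reasoning
    other-out-idle : ∀ i → src i ≡ src e → i ≢ e → pending (c i) ≡ 0
    other-out-idle i srcᵢ≡u i≢e =
      pending-≡0 (λ redᵢ → i≢e (red-unique i e redᵢ red srcᵢ≡u)) (no-green i srcᵢ≡u)

  invariant-red-out : ∀ {s} e → NoBlackIn s → NoGreenOut s → current s ≢ v₀ → src e ≡ current s →
    colour s e ≡ Red → Invariant s → Invariant ⟨ recolour (colour s) e Dashed , reached s , tgt e ⟩
  invariant-red-out {⟨ c , r , u ⟩} e no-black no-green u≢v₀ refl red I = record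
    { v₀-reached      = v₀-reached
    ; current-reached = proj₂ ends
    ; touched-reached = touched-recolour {r = r} id (proj₁ ends) (proj₂ ends) touched-reached
    ; red-unique      = λ i j redᵢ redⱼ →
        red-unique i j (red-before c e i redᵢ λ ()) (red-before c e j redⱼ λ ())
    ; red-off-v₀      = λ i red → red-off-v₀ i (red-before c e i red λ ())
    ; red-walk        = walk
    ; unit-flow       = unitFlow-forward refl (cong pending red) unit-flow
    ; red-or-finished = red-or-finished′
    }
    where
    open Invariant I
    ends = touched-reached e (≡-≢-trans red λ ())
    finished = red-exit⇒Finished e no-black no-green u≢v₀ red I
    src-elsewhere : ∀ i → recolour c e Dashed i ≡ Red → src i ≢ src e
    src-elsewhere i red′ srcᵢ≡u with red-unique i e (red-before c e i red′ λ ()) red srcᵢ≡u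
    ... | refl = contradiction (trans (sym (recolour-at c e Dashed)) red′) λ ()
    walk : ∀ i → recolour c e Dashed i ≡ Red → RedWalk (recolour c e Dashed) (src i)
    walk i red′ =
      walk-mono (λ {j} (redⱼ , srcⱼ≢u) → recolour-keeps c e j (λ { refl → contradiction refl srcⱼ≢u }) redⱼ)
        (walk-avoids (red-walk i (red-before c e i red′ λ ())) (src-elsewhere i red′)
                     (λ j redⱼ tgtⱼ≡u → contradiction (trans (sym redⱼ) (finished j tgtⱼ≡u)) λ ()))
    red-or-finished′ : ∀ x → r x ≡ true → x ≢ v₀ →
      HasRedOut (recolour c e Dashed) x ⊎ Finished (recolour c e Dashed) x
    red-or-finished′ x reachedₓ x≢v₀ with x ≟ src e
    ... | yes refl = inj₂ (Finished-recolour (λ _ → refl) finished)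
    ... | no x≢u   = map (HasRedOut-recolour (λ srcₑ≡x → contradiction (sym srcₑ≡x) x≢u))
                         (Finished-recolour (λ _ → refl)) (red-or-finished x reachedₓ x≢v₀)

  invariant-step : ∀ {s t} → Step s t → Invariant s → Invariant t
  invariant-step (black-new e tgtₑ≡u black unreached) = invariant-black-new e tgtₑ≡u black unreached
  invariant-step (black-old e tgtₑ≡u black reachedₑ)  = invariant-black-old e tgtₑ≡u black reachedₑ
  invariant-step (green-out e _ srcₑ≡u green)         = invariant-green-out e srcₑ≡u green
  invariant-step (red-out e no-black no-green u≢v₀ srcₑ≡u red) =
    invariant-red-out e no-black no-green u≢v₀ srcₑ≡u red

  invariant-run : ∀ {s t} → Star Step s t → Invariant s → Invariant t
  invariant-run ε          I = I
  invariant-run (st ◅ run) I = invariant-run run (invariant-step st I)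

  terminated⇒all-dashed : ∀ {s} → StronglyConnected G → Invariant s → Terminated s →
                          ∀ e → colour s e ≡ Dashed
  terminated⇒all-dashed {⟨ c , r , u ⟩} connected I (refl , no-black , no-green) e =
    reached⇒finished (tgt e) (all-reached (tgt e)) e refl
    where
    open Invariant I
    v₀-finished : Finished c v₀
    v₀-finished = idle-in⇒Finished no-black (unitFlow-no-inflow unit-flow (cong (_+ δ v₀ v₀) out-idle))
      where
      out-idle : flow src (pending ∘ c) v₀ ≡ 0
      out-idle = flow-≡0⁺ src λ i srcᵢ≡v₀ →
        pending-≡0 (λ red → red-off-v₀ i red srcᵢ≡v₀) (no-green i srcᵢ≡v₀)
    no-red : ∀ i → c i ≢ Red
    no-red i red with walk-last-edge (red-walk i red) (red-off-v₀ i red)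
    ... | j , tgtⱼ≡v₀ , redⱼ = contradiction (trans (sym redⱼ) (v₀-finished j tgtⱼ≡v₀)) λ ()
    reached⇒finished : ∀ x → r x ≡ true → Finished c x
    reached⇒finished x reachedₓ with x ≟ v₀
    ... | yes refl = v₀-finished
    ... | no x≢v₀  =
      [ (λ (i , _ , red) → contradiction red (no-red i)) , id ] (red-or-finished x reachedₓ x≢v₀)
    all-reached : ∀ x → r x ≡ true
    all-reached x = reach-backwards
      (λ i reachedₜ → proj₁ (touched-reached i (≡-≢-trans (reached⇒finished _ reachedₜ i refl) λ ())))
      (connected x v₀) v₀-reached

corollary10 : (G : Multigraph) → Eulerian G → (v₀ : Fin (Multigraph.n G)) →
    (s : Procedure.State G v₀) →
    Star (Procedure.Step G v₀) (Procedure.initial G v₀) s →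
    Procedure.Terminated G v₀ s →
    ∀ e → Procedure.State.colour s e ≡ Dashed
corollary10 G (connected , _) v₀ s run terminated =
  terminated⇒all-dashed connected (invariant-run run initial-invariant) terminated
  where open Correctness G v₀
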